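{- Let $f:\{0,1\}^n\to\{0,1\}$ be monotone and let $x^{\star}\in\{0,1\}^n$ satisfy $f(x^{\star})=1$. Algorithm CERT (described in the context), run on $f$ and $x^{\star}$, terminates after making at most $O(C(f)\log n)$ queries to $f$.
   Context: For $S\subseteq[n]$, $x_S\in\{0,1\}^n$ denotes the indicator vector of $S$ and $x|_S$ the restriction of $x$ to coordinates in $S$; $S_{x}=\{i:x_i=1\}$; $[s]=\{1,\dots,s\}$ and $[0]=\emptyset$. $f$ is monotone if $x\le y$ coordinatewise implies $f(x)\le f(y)$. A set $S\subseteq[n]$ is a certificate for $f$ at $x$ if every $y$ with $y|_S=x|_S$ satisfies $f(y)=f(x)$; $C(f,x)$ is the minimum size of such a certificate and $C(f)=\max_x C(f,x)$. The procedure $\mathsf{search}(f,A,S)$, for $A,S\subseteq[n]$: if $f(x_A)=1$ or $f(x_{A\cup S})=0$ it outputs $\mathsf{ERROR}$; otherwise it outputs the smallest $s\in S$ with $f(x_{A\cup([s]\cap S)})=1$, found by binary search over $S$ using queries to $f$. Algorithm CERT: initialize $A\gets\emptyset$, $S\gets S_{x^{\star}}$; while $f(x_A)\ne 1$ (checked by one query), do: $s\gets\mathsf{search}(f,A,S)$; $A\gets A\cup\{s\}$; $S\gets S\cap[s-1]$. When $f(x_A)=1$, output $A$. -}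

module Defs where

open import Data.Bool using (Bool; true; false; _≤_)
open import Data.Nat using (ℕ; zero; suc; _<ᵇ_; _/_) renaming (_≤_ to _≤ℕ_)
open import Data.Fin using (Fin; toℕ)
open import Data.Fin.Subset using (Subset; _∈_; _⊆_; _∪_; _∩_; ⁅_⁆; ⊥; ∣_∣)
open import Data.List using (List; []; _∷_; filterᵇ; allFin; take; drop; length; foldr)
open import Data.Vec using (lookup; tabulate)
open import Data.Maybe using (Maybe; just; nothing)
open import Data.Product using (_×_; _,_; ∃-syntax; proj₁; proj₂)
open import Relation.Binary.PropositionalEquality using (_≡_)

-- A point x ∈ {0,1}^n is identified with
-- the subset S_x = {i : x_i = 1}; Data.Fin.Subset n is literally Vec Bool n,
-- so x_S (the indicator vector of S) is S itself.

BoolFun : ℕ → Set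
BoolFun n = Subset n → Bool

Monotone : ∀ {n} → BoolFun n → Set
Monotone {n} f = ∀ (x y : Subset n) → x ⊆ y → f x ≤ f y

IsCertificate : ∀ {n} → BoolFun n → Subset n → Subset n → Set
IsCertificate {n} f x S =
  ∀ (y : Subset n) → (∀ (i : Fin n) → i ∈ S → lookup y i ≡ lookup x i) → f y ≡ f x

IsCertComplexityAt : ∀ {n} → BoolFun n → Subset n → ℕ → Set
IsCertComplexityAt {n} f x k =
  (∃[ S ] (IsCertificate f x S × ∣ S ∣ ≡ k)) ×
  (∀ (S : Subset n) → IsCertificate f x S → k ≤ℕ ∣ S ∣)

IsCertComplexity : ∀ {n} → BoolFun n → ℕ → Set
IsCertComplexity {n} f k =
  (∀ (x : Subset n) (kx : ℕ) → IsCertComplexityAt f x kx → kx ≤ℕ k) ×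
  (∃[ x ] IsCertComplexityAt f x k)

data Query (n : ℕ) (A : Set) : Set where
  ret : A → Query n A
  ask : Subset n → (Bool → Query n A) → Query n A

_>>=_ : ∀ {n} {A B : Set} → Query n A → (A → Query n B) → Query n B
ret a   >>= k = k a
ask q c >>= k = ask q (λ b → c b >>= k)

run : ∀ {n} {A : Set} → BoolFun n → Query n A → A × ℕ
run f (ret a)   = a , 0
run f (ask q c) = proj₁ (run f (c (f q))) , suc (proj₂ (run f (c (f q))))

elems : ∀ {n} → Subset n → List (Fin n)
elems {n} S = filterᵇ (λ i → lookup S i) (allFin n)

fromList : ∀ {n} → List (Fin n) → Subset n
fromList = foldr (λ i P → ⁅ i ⁆ ∪ P) ⊥

-- the set {i : i < s}, i.e. [s-1] in the paper's 1-based notation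
below : ∀ {n} → Fin n → Subset n
below s = tabulate (λ i → toℕ i <ᵇ toℕ s)

-- Given P with f(P) = 0 and a list L (an increasing list of
-- elements) with f(P ∪ L) = 1, find the first element s of L such that
-- f(P ∪ (elements of L up to s)) = 1, by halving L.  The fuel argument only
-- ensures structural termination; running out of fuel yields nothing.

bsearch : ∀ {n} → ℕ → Subset n → List (Fin n) → Query n (Maybe (Fin n))
bsearch zero    P L               = ret nothing
bsearch (suc k) P []              = ret nothing
bsearch (suc k) P (s ∷ [])        = ret (just s)
bsearch (suc k) P L@(_ ∷ _ ∷ _)   =
  ask (P ∪ fromList (take (length L / 2) L)) λ where
    true  → bsearch k P (take (length L / 2) L)
    false → bsearch k (P ∪ fromList (take (length L / 2) L)) (drop (length L / 2) L)

-- search(f, A, S): ERROR (= nothing) if f(x_A) = 1 or f(x_{A∪S}) = 0;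
-- otherwise the smallest s ∈ S with f(x_{A ∪ ([s] ∩ S)}) = 1, by binary search.
search : ∀ {n} → ℕ → Subset n → Subset n → Query n (Maybe (Fin n))
search k A S = ask A λ where
  true  → ret nothing
  false → ask (A ∪ S) λ where
    false → ret nothing
    true  → bsearch k A (elems S)

certLoop : ∀ {n} → ℕ → Subset n → Subset n → Query n (Maybe (Subset n))
certLoop zero    A S = ret nothing
certLoop (suc k) A S = ask A λ where
  true  → ret (just A)
  false → search k A S >>= λ where
    nothing  → ret nothing
    (just s) → certLoop k (A ∪ ⁅ s ⁆) (S ∩ below s)

CERT : ∀ {n} → ℕ → Subset n → Query n (Maybe (Subset n))
CERT fuel x⋆ = certLoop fuel ⊥ x⋆

module Submission where

-- Each round of CERT adds to A the first s ∈ S for which A ∪ ([s] ∩ S) is accepted, found by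
-- binary search with at most ⌈log₂ n⌉ queries plus three further ones. The loop keeps
-- f(A ∪ S) = 1 while f((A ∪ S) ∖ {a}) = 0 for every a ∈ A, so when it stops f(A) = 1 and, by
-- monotonicity, removing any element of A makes f zero: A is a minterm. For monotone f a minterm
-- is a certificate at itself contained in every other one, so |A| = C(f, A) ≤ C(f), and the |A|
-- rounds cost at most |A| (3 + ⌈log₂ n⌉) + 1 ≤ 4 C(f) ⌈log₂ n⌉ + 4 queries.


open import Defs
open import Data.Bool using (Bool; true; false)
import Data.Bool as Bool
open import Data.Bool.Properties using (T-≡; ≤-antisym; ≤-minimum; ≤-maximum)
open import Data.Nat using (ℕ; zero; suc; _+_; _*_; _∸_; _≤_; _<_; _<ᵇ_; _⊓_; z≤n; s≤s; ⌈_/2⌉; ⌊_/2⌋; _/_)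
import Data.Nat.Properties as ℕ
open import Data.Nat.Tactic.RingSolver using (solve-∀)
open import Data.Nat.DivMod using (m/n≡1+[m∸n]/n)
open import Data.Nat.Logarithm using (⌈log₂_⌉; ⌈log₂⌉-mono-≤; ⌈log₂⌈n/2⌉⌉≡⌈log₂n⌉∸1; ⌈log₂2^n⌉≡n)
open import Data.Fin using (Fin; toℕ) renaming (_<_ to _<ᶠ_)
open import Data.Fin.Subset using (Subset; _∈_; _∉_; _⊆_; _⊈_; _∪_; _∩_; _─_; _-_; ⁅_⁆; ⊥; ∣_∣; inside; outside)
open import Data.Fin.Subset.Properties
  using (x∈p∪q⁻; p⊆p∪q; q⊆p∪q; x∈p∩q⁺; x∈p∩q⁻; p∩q⊆p; x∈⁅x⁆; x∈⁅y⁆⇒x≡y; ∉⊥; p─q⊆p; x∈p∧x≢y⇒x∈p-y; ∪-assoc; ∪-identityˡ; ∪-identityʳ; p⊂q⇒∣p∣<∣q∣; p⊆q⇒∣p∣≤∣q∣; ∣p∣≤n; _∈?_)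
open import Data.List using (List; []; _∷_; _++_; length; take; drop; allFin)
import Data.List.Properties as List
import Data.List.Membership.Propositional as List
open import Data.List.Membership.Propositional.Properties using (∈-filter⁺; ∈-filter⁻; ∈-allFin; ∈-++⁺ˡ; ∈-++⁺ʳ; ∈-++⁻)
open import Data.List.Relation.Unary.Any using (here; there)
open import Data.List.Relation.Unary.All as All using (All; []; _∷_)
open import Data.List.Relation.Unary.All.Properties using (++⁻ʳ)
open import Data.List.Relation.Unary.AllPairs using (AllPairs; []; _∷_)
import Data.List.Relation.Unary.AllPairs.Properties as AllPairs
open import Data.Vec using ([]; _∷_; lookup)
import Data.Vec as Vec
import Data.Fin as Fin
open import Data.Vec.Properties using ([]=⇒lookup; lookup⇒[]=; lookup∘tabulate)
open import Data.Maybe using (just)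
open import Data.Product using (_×_; _,_; ∃-syntax; proj₁; proj₂; map₂)
open import Data.Sum using (inj₁; inj₂; [_,_]′)
open import Data.Empty using (⊥-elim)
open import Relation.Nullary using (yes; no)
open import Function using (_∘_; id; Equivalence)
open import Relation.Binary.PropositionalEquality using (_≡_; _≢_; refl; sym; trans; cong; subst; module ≡-Reasoning)

∪-lub : ∀ {n} {p q r : Subset n} → p ⊆ r → q ⊆ r → p ∪ q ⊆ r
∪-lub {p = p} {q} p⊆r q⊆r x∈ = [ p⊆r , q⊆r ]′ (x∈p∪q⁻ p q x∈)

∪-monoʳ-⊆ : ∀ {n} (p : Subset n) {q r} → q ⊆ r → p ∪ q ⊆ p ∪ r
∪-monoʳ-⊆ p {q} {r} q⊆r = ∪-lub (p⊆p∪q r) (q⊆p∪q p r ∘ q⊆r)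

x∈p⇒⁅x⁆⊆p : ∀ {n} {p : Subset n} {x} → x ∈ p → ⁅ x ⁆ ⊆ p
x∈p⇒⁅x⁆⊆p {p = p} {x} x∈p y∈ = subst (_∈ p) (sym (x∈⁅y⁆⇒x≡y x y∈)) x∈p

x∉p⇒∣p∣<∣p∪⁅x⁆∣ : ∀ {n} {p : Subset n} {x} → x ∉ p → ∣ p ∣ < ∣ p ∪ ⁅ x ⁆ ∣
x∉p⇒∣p∣<∣p∪⁅x⁆∣ {p = p} {x} x∉p = p⊂q⇒∣p∣<∣q∣ (p⊆p∪q ⁅ x ⁆ , x , q⊆p∪q p ⁅ x ⁆ (x∈⁅x⁆ x) , x∉p)

x∈p─q⇒x∉q : ∀ {n} {p q : Subset n} {x} → x ∈ p ─ q → x ∉ q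
x∈p─q⇒x∉q {p = _ ∷ _} {outside ∷ _} Vec.here       ()
x∈p─q⇒x∉q {p = _ ∷ _} {_       ∷ _} (Vec.there x∈) (Vec.there x∈q) = x∈p─q⇒x∉q x∈ x∈q

x∈p-y⇒x≢y : ∀ {n} {p : Subset n} {x y} → x ∈ p - y → x ≢ y
x∈p-y⇒x≢y {y = y} x∈ refl = x∈p─q⇒x∉q x∈ (x∈⁅x⁆ y)

p⊆q⇒p-x⊆q-x : ∀ {n} {p q : Subset n} {x} → p ⊆ q → p - x ⊆ q - x
p⊆q⇒p-x⊆q-x {p = p} {x = x} p⊆q y∈ = x∈p∧x≢y⇒x∈p-y (p⊆q (p─q⊆p p ⁅ x ⁆ y∈)) (x∈p-y⇒x≢y y∈)

lookup-─ : ∀ {n} (p q : Subset n) {x} → x ∉ q → lookup (p ─ q) x ≡ lookup p x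
lookup-─ (_ ∷ _) (outside ∷ _) {Fin.zero}  _   = refl
lookup-─ (_ ∷ _) (inside  ∷ _) {Fin.zero}  x∉q = ⊥-elim (x∉q Vec.here)
lookup-─ (_ ∷ p) (_       ∷ q) {Fin.suc x} x∉q = lookup-─ p q (x∉q ∘ Vec.there)

∈⇒lookup≡true : ∀ {n} {S : Subset n} {x} → x ∈ S → lookup S x ≡ true
∈⇒lookup≡true = []=⇒lookup

lookup≡true⇒∈ : ∀ {n} {S : Subset n} {x} → lookup S x ≡ true → x ∈ S
lookup≡true⇒∈ {S = S} {x} = lookup⇒[]= x S

∈-fromList⁺ : ∀ {n} {xs : List (Fin n)} {x} → x List.∈ xs → x ∈ fromList xs
∈-fromList⁺ {xs = x ∷ xs} (here refl) = p⊆p∪q (fromList xs) (x∈⁅x⁆ x)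
∈-fromList⁺ {xs = y ∷ xs} (there x∈) = q⊆p∪q ⁅ y ⁆ (fromList xs) (∈-fromList⁺ x∈)

∈-fromList⁻ : ∀ {n} {xs : List (Fin n)} {x} → x ∈ fromList xs → x List.∈ xs
∈-fromList⁻ {xs = []}     x∈ = ⊥-elim (∉⊥ x∈)
∈-fromList⁻ {xs = y ∷ xs} x∈ with x∈p∪q⁻ ⁅ y ⁆ (fromList xs) x∈
... | inj₁ x∈⁅y⁆ = here (x∈⁅y⁆⇒x≡y y x∈⁅y⁆)
... | inj₂ x∈xs  = there (∈-fromList⁻ x∈xs)

fromList-++ : ∀ {n} (xs ys : List (Fin n)) → fromList (xs ++ ys) ≡ fromList xs ∪ fromList ys
fromList-++ []       ys = sym (∪-identityˡ (fromList ys))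
fromList-++ (x ∷ xs) ys = begin
  ⁅ x ⁆ ∪ fromList (xs ++ ys)          ≡⟨ cong (⁅ x ⁆ ∪_) (fromList-++ xs ys) ⟩
  ⁅ x ⁆ ∪ (fromList xs ∪ fromList ys)  ≡⟨ ∪-assoc ⁅ x ⁆ (fromList xs) (fromList ys) ⟨
  (⁅ x ⁆ ∪ fromList xs) ∪ fromList ys  ∎
  where open ≡-Reasoning

∪-fromList-++ : ∀ {n} (p : Subset n) (xs ys : List (Fin n)) →
                p ∪ fromList (xs ++ ys) ≡ (p ∪ fromList xs) ∪ fromList ys
∪-fromList-++ p xs ys =
  trans (cong (p ∪_) (fromList-++ xs ys)) (sym (∪-assoc p (fromList xs) (fromList ys)))

∈-elems⁺ : ∀ {n} {S : Subset n} {x} → x ∈ S → x List.∈ elems S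
∈-elems⁺ {S = S} {x} x∈S =
  ∈-filter⁺ (Bool.T? ∘ lookup S) (∈-allFin x) (Equivalence.from T-≡ (∈⇒lookup≡true x∈S))

∈-elems⁻ : ∀ {n} {S : Subset n} {x} → x List.∈ elems S → x ∈ S
∈-elems⁻ {n} {S} x∈ =
  lookup≡true⇒∈ (Equivalence.to T-≡ (proj₂ (∈-filter⁻ (Bool.T? ∘ lookup S) {xs = allFin n} x∈)))

length-elems : ∀ {n} (S : Subset n) → length (elems S) ≤ n
length-elems {n} S = ℕ.≤-trans (List.length-filter (Bool.T? ∘ lookup S) (allFin n))
                               (ℕ.≤-reflexive (List.length-tabulate id))

elems-increasing : ∀ {n} (S : Subset n) → AllPairs _<ᶠ_ (elems S)
elems-increasing S = AllPairs.filter⁺ (Bool.T? ∘ lookup S) (AllPairs.tabulate⁺-< id)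

S⊆fromList-elems : ∀ {n} (S : Subset n) → S ⊆ fromList (elems S)
S⊆fromList-elems S = ∈-fromList⁺ ∘ ∈-elems⁺

∈-below⁺ : ∀ {n} {x s : Fin n} → x <ᶠ s → x ∈ below s
∈-below⁺ {x = x} {s} x<s = lookup≡true⇒∈
  (trans (lookup∘tabulate (λ i → toℕ i <ᵇ toℕ s) x) (Equivalence.to T-≡ (ℕ.<⇒<ᵇ x<s)))

∈-below⁻ : ∀ {n} {x s : Fin n} → x ∈ below s → x <ᶠ s
∈-below⁻ {x = x} {s} x∈ = ℕ.<ᵇ⇒< (toℕ x) (toℕ s)
  (Equivalence.from T-≡ (trans (sym (lookup∘tabulate (λ i → toℕ i <ᵇ toℕ s) x)) (∈⇒lookup≡true x∈)))

AllPairs-++∷ : ∀ {a r} {A : Set a} {R : A → A → Set r} (xs : List A) {y ys} →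
               AllPairs R (xs ++ y ∷ ys) → All (λ x → R x y) xs × All (R y) ys
AllPairs-++∷ []       (y<ys ∷ _)    = [] , y<ys
AllPairs-++∷ (x ∷ xs) (x<ys ∷ rest) with AllPairs-++∷ xs rest
... | xs<y , y<ys = All.head (++⁻ʳ xs x<ys) ∷ xs<y , y<ys

module _ {n} {S : Subset n} {pre : List (Fin n)} {s : Fin n} {rest : List (Fin n)}
         (split : elems S ≡ pre ++ s ∷ rest) where

  private
    increasing : All (_<ᶠ s) pre × All (s <ᶠ_) rest
    increasing = AllPairs-++∷ pre (subst (AllPairs _<ᶠ_) split (elems-increasing S))

  elems-pivot∈ : s ∈ S
  elems-pivot∈ = ∈-elems⁻ (subst (s List.∈_) (sym split) (∈-++⁺ʳ pre (here refl)))

  elems-prefix⊆ : fromList pre ⊆ S ∩ below s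
  elems-prefix⊆ x∈ = x∈p∩q⁺ ( ∈-elems⁻ (subst (_ List.∈_) (sym split) (∈-++⁺ˡ x∈pre))
                             , ∈-below⁺ (All.lookup (proj₁ increasing) x∈pre))
    where
    x∈pre : _ List.∈ pre
    x∈pre = ∈-fromList⁻ x∈

  elems-prefix⊇ : S ∩ below s ⊆ fromList pre
  elems-prefix⊇ {x} x∈ with x∈p∩q⁻ S (below s) x∈
  ... | x∈S , x∈below with ∈-++⁻ pre (subst (x List.∈_) split (∈-elems⁺ x∈S))
  ...   | inj₁ x∈pre             = ∈-fromList⁺ x∈pre
  ...   | inj₂ (here refl)       = ⊥-elim (ℕ.<-irrefl refl (∈-below⁻ x∈below))
  ...   | inj₂ (there x∈rest)    = ⊥-elim (ℕ.<-asym (∈-below⁻ x∈below) (All.lookup (proj₂ increasing) x∈rest))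

m≤⌈n/2⌉∧n≤1+k⇒m≤k : ∀ {l m k} → m ≤ ⌈ 2 + l /2⌉ → 2 + l ≤ suc k → m ≤ k
m≤⌈n/2⌉∧n≤1+k⇒m≤k {l} m≤ n≤ = ℕ.≤-pred (ℕ.≤-trans (s≤s m≤) (ℕ.≤-trans (ℕ.⌈n/2⌉<n l) n≤))

m/2≡⌊m/2⌋ : ∀ m → m / 2 ≡ ⌊ m /2⌋
m/2≡⌊m/2⌋ zero          = refl
m/2≡⌊m/2⌋ (suc zero)    = refl
m/2≡⌊m/2⌋ (suc (suc m)) = trans (m/n≡1+[m∸n]/n {suc (suc m)} {2} (s≤s (s≤s z≤n))) (cong suc (m/2≡⌊m/2⌋ m))

length-take-half : ∀ {a} {A : Set a} (xs : List A) → length (take (length xs / 2) xs) ≤ ⌈ length xs /2⌉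
length-take-half xs = begin
  length (take (length xs / 2) xs)  ≡⟨ List.length-take (length xs / 2) xs ⟩
  length xs / 2 ⊓ length xs         ≤⟨ ℕ.m⊓n≤m _ _ ⟩
  length xs / 2                     ≡⟨ m/2≡⌊m/2⌋ (length xs) ⟩
  ⌊ length xs /2⌋                   ≤⟨ ℕ.⌊n/2⌋≤⌈n/2⌉ (length xs) ⟩
  ⌈ length xs /2⌉                   ∎
  where open ℕ.≤-Reasoning

length-drop-half : ∀ {a} {A : Set a} (xs : List A) → length (drop (length xs / 2) xs) ≡ ⌈ length xs /2⌉
length-drop-half xs = begin
  length (drop (length xs / 2) xs)    ≡⟨ List.length-drop (length xs / 2) xs ⟩
  length xs ∸ length xs / 2           ≡⟨ cong (length xs ∸_) (m/2≡⌊m/2⌋ (length xs)) ⟩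
  length xs ∸ ⌊ length xs /2⌋         ≡⟨ cong (_∸ ⌊ length xs /2⌋) (ℕ.⌊n/2⌋+⌈n/2⌉≡n (length xs)) ⟨
  ⌊ length xs /2⌋ + ⌈ length xs /2⌉ ∸ ⌊ length xs /2⌋  ≡⟨ ℕ.m+n∸m≡n ⌊ length xs /2⌋ _ ⟩
  ⌈ length xs /2⌉                     ∎
  where open ≡-Reasoning

2≤m⇒1≤⌈log₂m⌉ : ∀ {m} → 2 ≤ m → 1 ≤ ⌈log₂ m ⌉
2≤m⇒1≤⌈log₂m⌉ {m} 2≤m = subst (_≤ ⌈log₂ m ⌉) (⌈log₂2^n⌉≡n 1) (⌈log₂⌉-mono-≤ 2≤m)

1+⌈log₂⌈m/2⌉⌉≡⌈log₂m⌉ : ∀ m → 2 ≤ m → suc ⌈log₂ ⌈ m /2⌉ ⌉ ≡ ⌈log₂ m ⌉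
1+⌈log₂⌈m/2⌉⌉≡⌈log₂m⌉ m 2≤m = begin
  suc ⌈log₂ ⌈ m /2⌉ ⌉      ≡⟨ cong suc (⌈log₂⌈n/2⌉⌉≡⌈log₂n⌉∸1 m) ⟩
  suc (⌈log₂ m ⌉ ∸ 1)      ≡⟨ ℕ.m+[n∸m]≡n (2≤m⇒1≤⌈log₂m⌉ 2≤m) ⟩
  ⌈log₂ m ⌉                ∎
  where open ≡-Reasoning

⌈log₂⌉-halving : ∀ {l m q} → 2 ≤ l → m ≤ ⌈ l /2⌉ → q ≤ ⌈log₂ m ⌉ → suc q ≤ ⌈log₂ l ⌉
⌈log₂⌉-halving {l} 2≤l m≤ q≤ = ℕ.≤-trans (s≤s (ℕ.≤-trans q≤ (⌈log₂⌉-mono-≤ m≤)))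
                                         (ℕ.≤-reflexive (1+⌈log₂⌈m/2⌉⌉≡⌈log₂m⌉ l 2≤l))

round-cost : ∀ {q l a a′ q′ r} → q ≤ l → suc a ≤ a′ → q′ + a′ * (3 + l) ≤ r →
             3 + (q + q′) + a * (3 + l) ≤ r
round-cost {q} {l} {a} {a′} {q′} {r} q≤l a<a′ rest = begin
  3 + (q + q′) + a * (3 + l)   ≤⟨ ℕ.+-monoˡ-≤ (a * (3 + l)) (ℕ.+-monoˡ-≤ q′ (ℕ.+-monoʳ-≤ 3 q≤l)) ⟩
  (3 + l) + q′ + a * (3 + l)   ≡⟨ cong (_+ a * (3 + l)) (ℕ.+-comm (3 + l) q′) ⟩
  q′ + (3 + l) + a * (3 + l)   ≡⟨ ℕ.+-assoc q′ (3 + l) (a * (3 + l)) ⟩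
  q′ + suc a * (3 + l)         ≤⟨ ℕ.+-monoʳ-≤ q′ (ℕ.*-monoˡ-≤ (3 + l) a<a′) ⟩
  q′ + a′ * (3 + l)            ≤⟨ rest ⟩
  r                            ∎
  where open ℕ.≤-Reasoning

m≤k∧m≤n⇒m≤k*⌈log₂n⌉+1 : ∀ {a k n} → a ≤ k → a ≤ n → a ≤ k * ⌈log₂ n ⌉ + 1
m≤k∧m≤n⇒m≤k*⌈log₂n⌉+1 {n = zero}        _   a≤0 = ℕ.≤-trans a≤0 z≤n
m≤k∧m≤n⇒m≤k*⌈log₂n⌉+1 {k = k} {suc zero} _   a≤1 = ℕ.≤-trans a≤1 (ℕ.m≤n+m 1 (k * 0))
m≤k∧m≤n⇒m≤k*⌈log₂n⌉+1 {k = k} {n@(suc (suc _))} a≤k _ = begin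
  _                  ≤⟨ a≤k ⟩
  k                  ≡⟨ ℕ.*-identityʳ k ⟨
  k * 1              ≤⟨ ℕ.*-monoʳ-≤ k (2≤m⇒1≤⌈log₂m⌉ {n} (s≤s (s≤s z≤n))) ⟩
  k * ⌈log₂ n ⌉      ≤⟨ ℕ.m≤m+n _ 1 ⟩
  k * ⌈log₂ n ⌉ + 1  ∎
  where open ℕ.≤-Reasoning

query-bound : ∀ {a k n q} → a ≤ k → a ≤ n → q ≤ a * (3 + ⌈log₂ n ⌉) + 1 → q ≤ 4 * k * ⌈log₂ n ⌉ + 4
query-bound {a} {k} {n} {q} a≤k a≤n q≤ = begin
  q                                        ≤⟨ q≤ ⟩
  a * (3 + ⌈log₂ n ⌉) + 1                  ≡⟨ cong (_+ 1) (ℕ.*-distribˡ-+ a 3 ⌈log₂ n ⌉) ⟩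
  a * 3 + a * ⌈log₂ n ⌉ + 1                ≤⟨ ℕ.+-monoˡ-≤ 1 (ℕ.+-mono-≤ (ℕ.*-monoˡ-≤ 3 (m≤k∧m≤n⇒m≤k*⌈log₂n⌉+1 a≤k a≤n))
                                                                      (ℕ.*-monoˡ-≤ ⌈log₂ n ⌉ a≤k)) ⟩
  (k * ⌈log₂ n ⌉ + 1) * 3 + k * ⌈log₂ n ⌉ + 1  ≡⟨ 4-fold k ⌈log₂ n ⌉ ⟩
  4 * k * ⌈log₂ n ⌉ + 4                    ∎
  where
  open ℕ.≤-Reasoning
  4-fold : ∀ k l → (k * l + 1) * 3 + k * l + 1 ≡ 4 * k * l + 4
  4-fold = solve-∀

module _ {n} (f : BoolFun n) where

  run->>= : ∀ {A B : Set} (p : Query n A) {g : A → Query n B} {a b m₁ m₂} →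
            run f p ≡ (a , m₁) → run f (g a) ≡ (b , m₂) → run f (p >>= g) ≡ (b , m₁ + m₂)
  run->>= (ret _)   refl eq₂ = eq₂
  run->>= (ask Q c) eq₁  eq₂ with run f (c (f Q)) in eq
  run->>= (ask Q c) refl eq₂ | _ = cong (map₂ suc) (run->>= (c (f Q)) eq eq₂)

  run-bsearch-front : ∀ {k P a b t} → let L = a ∷ b ∷ t ; front = take (length L / 2) L in
    f (P ∪ fromList front) ≡ true → run f (bsearch (suc k) P L) ≡ map₂ suc (run f (bsearch k P front))
  run-bsearch-front fP∪front rewrite fP∪front = refl

  run-bsearch-back : ∀ {k P a b t} → let L = a ∷ b ∷ t ; front = take (length L / 2) L in
    f (P ∪ fromList front) ≡ false →
    run f (bsearch (suc k) P L) ≡ map₂ suc (run f (bsearch k (P ∪ fromList front) (drop (length L / 2) L)))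
  run-bsearch-back fP∪front rewrite fP∪front = refl

  run-certLoop-accept : ∀ {k A S} → f A ≡ true → run f (certLoop (suc k) A S) ≡ (just A , 1)
  run-certLoop-accept fA rewrite fA = refl

  run-certLoop-continue : ∀ {k A S s q A′ q′} → f A ≡ false → f (A ∪ S) ≡ true →
    run f (bsearch k A (elems S)) ≡ (just s , q) →
    run f (certLoop k (A ∪ ⁅ s ⁆) (S ∩ below s)) ≡ (A′ , q′) →
    run f (certLoop (suc k) A S) ≡ (A′ , 3 + (q + q′))
  -- f A is queried twice: by the loop guard and again by search.
  run-certLoop-continue {k} {A} {S} fA fAS bs loop rewrite fA | fA | fAS =
    cong (map₂ (3 +_)) (run->>= (bsearch k A (elems S)) bs loop)

  record Pivot (P : Subset n) (L : List (Fin n)) (s : Fin n) : Set where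
    field
      pre rest : List (Fin n)
      split    : L ≡ pre ++ s ∷ rest
      rejects  : f (P ∪ fromList pre) ≡ false
      accepts  : f ((P ∪ fromList pre) ∪ ⁅ s ⁆) ≡ true

  pivot-++ʳ : ∀ {P T s} D → Pivot P T s → Pivot P (T ++ D) s
  pivot-++ʳ {s = s} D p = record
    { pre = pre ; rest = rest ++ D
    ; split = trans (cong (_++ D) split) (List.++-assoc pre (s ∷ rest) D)
    ; rejects = rejects ; accepts = accepts }
    where open Pivot p

  pivot-++ˡ : ∀ {P D s} T → Pivot (P ∪ fromList T) D s → Pivot P (T ++ D) s
  pivot-++ˡ {P} {s = s} T p = record
    { pre = T ++ pre ; rest = rest
    ; split = trans (cong (T ++_) split) (sym (List.++-assoc T pre (s ∷ rest)))
    ; rejects = subst (λ X → f X ≡ false) (sym (∪-fromList-++ P T pre)) rejects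
    ; accepts = subst (λ X → f (X ∪ ⁅ s ⁆) ≡ true) (sym (∪-fromList-++ P T pre)) accepts }
    where open Pivot p

  record BinarySearch (k : ℕ) (P : Subset n) (L : List (Fin n)) : Set where
    field
      pivot   : Fin n
      queries : ℕ
      runs    : run f (bsearch k P L) ≡ (just pivot , queries)
      cost    : queries ≤ ⌈log₂ length L ⌉
      isPivot : Pivot P L pivot

  bsearch-finds : ∀ k P L → length L ≤ k → f P ≡ false → f (P ∪ fromList L) ≡ true → BinarySearch k P L
  bsearch-finds _       P []            _   fP fPL with trans (sym fPL) (trans (cong f (∪-identityʳ P)) fP)
  ... | ()
  bsearch-finds zero    P (_ ∷ _)       ()
  bsearch-finds (suc k) P (s ∷ [])      _   fP fPL = record
    { pivot = s ; queries = 0 ; runs = refl ; cost = z≤n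
    ; isPivot = record { pre = [] ; rest = [] ; split = refl
                       ; rejects = subst (λ X → f X ≡ false) (sym (∪-identityʳ P)) fP
                       ; accepts = subst (λ X → f X ≡ true) ∪⊥-shuffle fPL } }
    where
    ∪⊥-shuffle : P ∪ (⁅ s ⁆ ∪ ⊥) ≡ (P ∪ ⊥) ∪ ⁅ s ⁆
    ∪⊥-shuffle = trans (cong (P ∪_) (∪-identityʳ ⁅ s ⁆)) (cong (_∪ ⁅ s ⁆) (sym (∪-identityʳ P)))
  bsearch-finds (suc k) P L@(_ ∷ _ ∷ _) len fP fPL = halve (f (P ∪ fromList T)) refl
    where
    T D : List (Fin n)
    T = take (length L / 2) L
    D = drop (length L / 2) L

    rejoin : ∀ {s} → Pivot P (T ++ D) s → Pivot P L s
    rejoin = subst (λ L′ → Pivot P L′ _) (List.take++drop≡id (length L / 2) L)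

    T≤ : length T ≤ ⌈ length L /2⌉
    T≤ = length-take-half L

    D≤ : length D ≤ ⌈ length L /2⌉
    D≤ = ℕ.≤-reflexive (length-drop-half L)

    fP∪T∪D : f ((P ∪ fromList T) ∪ fromList D) ≡ true
    fP∪T∪D = subst (λ X → f X ≡ true)
      (trans (cong (λ L′ → P ∪ fromList L′) (sym (List.take++drop≡id (length L / 2) L))) (∪-fromList-++ P T D))
      fPL

    halve : ∀ b → f (P ∪ fromList T) ≡ b → BinarySearch (suc k) P L
    halve true fPT = record
      { pivot = pivot ; queries = suc queries ; runs = trans (run-bsearch-front fPT) (cong (map₂ suc) runs)
      ; cost = ⌈log₂⌉-halving (s≤s (s≤s z≤n)) T≤ cost ; isPivot = rejoin (pivot-++ʳ D isPivot) }
      where open BinarySearch (bsearch-finds k P T (m≤⌈n/2⌉∧n≤1+k⇒m≤k T≤ len) fP fPT)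
    halve false fPT = record
      { pivot = pivot ; queries = suc queries ; runs = trans (run-bsearch-back fPT) (cong (map₂ suc) runs)
      ; cost = ⌈log₂⌉-halving (s≤s (s≤s z≤n)) D≤ cost ; isPivot = rejoin (pivot-++ˡ T isPivot) }
      where open BinarySearch (bsearch-finds k (P ∪ fromList T) D (m≤⌈n/2⌉∧n≤1+k⇒m≤k D≤ len) fPT fP∪T∪D)

module Monotonicity {n} {f : BoolFun n} (mono : Monotone f) where

  true-⊆ : ∀ {P Q} → P ⊆ Q → f P ≡ true → f Q ≡ true
  true-⊆ {P} {Q} P⊆Q fP = ≤-antisym (≤-maximum (f Q)) (subst (Bool._≤ f Q) fP (mono P Q P⊆Q))

  false-⊇ : ∀ {P Q} → P ⊆ Q → f Q ≡ false → f P ≡ false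
  false-⊇ {P} {Q} P⊆Q fQ = ≤-antisym (subst (f P Bool.≤_) fQ (mono P Q P⊆Q)) (≤-minimum (f P))

  true-false⇒⊈ : ∀ {P Q} → f P ≡ true → f Q ≡ false → P ⊈ Q
  true-false⇒⊈ fP fQ P⊆Q with trans (sym (true-⊆ P⊆Q fP)) fQ
  ... | ()

Minterm : ∀ {n} → BoolFun n → Subset n → Set
Minterm f x = f x ≡ true × (∀ {i} → i ∈ x → f (x - i) ≡ false)

IsCertificate-self : ∀ {n} {f : BoolFun n} → Monotone f → ∀ {x} → f x ≡ true → IsCertificate f x x
IsCertificate-self mono {x} fx y agree =
  trans (Monotonicity.true-⊆ mono (λ {i} i∈x → lookup≡true⇒∈ (trans (agree i i∈x) (∈⇒lookup≡true i∈x))) fx)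
        (sym fx)

minterm⊆IsCertificate : ∀ {n} {f : BoolFun n} {x S} → Minterm f x → IsCertificate f x S → x ⊆ S
minterm⊆IsCertificate {f = f} {x} {S} (fx , minimal) cert {i} i∈x with i ∈? S
... | yes i∈S = i∈S
... | no  i∉S = ⊥-elim (true≢false (trans (sym fx) (trans (sym (cert (x - i) agree)) (minimal i∈x))))
  where
  true≢false : true ≢ false
  true≢false ()
  agree : ∀ j → j ∈ S → lookup (x - i) j ≡ lookup x j
  agree j j∈S = lookup-─ x ⁅ i ⁆ (λ j∈⁅i⁆ → i∉S (subst (_∈ S) (x∈⁅y⁆⇒x≡y i j∈⁅i⁆) j∈S))

minterm⇒IsCertComplexityAt : ∀ {n} {f : BoolFun n} → Monotone f → ∀ {x} → Minterm f x → IsCertComplexityAt f x ∣ x ∣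
minterm⇒IsCertComplexityAt mono {x} m@(fx , _) =
  (x , IsCertificate-self mono fx , refl) , λ S cert → p⊆q⇒∣p∣≤∣q∣ (minterm⊆IsCertificate m cert)

module CertLoop {n} (f : BoolFun n) (mono : Monotone f) where

  open Monotonicity mono

  record SearchResult (k : ℕ) (A S : Subset n) : Set where
    field
      pivot   : Fin n
      queries : ℕ
      runs    : run f (bsearch k A (elems S)) ≡ (just pivot , queries)
      cost    : queries ≤ ⌈log₂ n ⌉
      pivot∈S : pivot ∈ S
      rejects : f (A ∪ (S ∩ below pivot)) ≡ false
      accepts : f ((A ∪ ⁅ pivot ⁆) ∪ (S ∩ below pivot)) ≡ true

  search-finds : ∀ {k A S} → n ≤ k → f A ≡ false → f (A ∪ S) ≡ true → SearchResult k A S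
  search-finds {k} {A} {S} n≤k fA fA∪S = record
    { pivot = pivot ; queries = queries ; runs = runs
    ; cost = ℕ.≤-trans cost (⌈log₂⌉-mono-≤ (length-elems S))
    ; pivot∈S = elems-pivot∈ split
    ; rejects = false-⊇ (∪-monoʳ-⊆ A (elems-prefix⊇ split)) rejects
    ; accepts = true-⊆ (∪-lub (∪-lub (p⊆p∪q _ ∘ p⊆p∪q _) (q⊆p∪q _ _ ∘ elems-prefix⊆ split))
                              (p⊆p∪q _ ∘ q⊆p∪q A _)) accepts }
    where
    open BinarySearch (bsearch-finds f k A (elems S) (ℕ.≤-trans (length-elems S) n≤k) fA
                                     (true-⊆ (∪-monoʳ-⊆ A (S⊆fromList-elems S)) fA∪S))
    open Pivot isPivot

  record Invariant (A S : Subset n) : Set where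
    field
      accepts  : f (A ∪ S) ≡ true
      critical : ∀ {i} → i ∈ A → f ((A ∪ S) - i) ≡ false

  module _ {k A S} (inv : Invariant A S) (r : SearchResult k A S) where
    open Invariant inv
    open SearchResult r using (pivot; pivot∈S; rejects) renaming (accepts to accepts′)

    pivot∉A : pivot ∉ A
    pivot∉A pivot∈A = true-false⇒⊈ accepts′ rejects
      (∪-lub (∪-lub (p⊆p∪q _) (p⊆p∪q _ ∘ x∈p⇒⁅x⁆⊆p pivot∈A)) (q⊆p∪q A _))

    invariant-step : Invariant (A ∪ ⁅ pivot ⁆) (S ∩ below pivot)
    invariant-step = record { accepts = accepts′ ; critical = critical′ }
      where
      shrinks : (A ∪ ⁅ pivot ⁆) ∪ (S ∩ below pivot) ⊆ A ∪ S
      shrinks = ∪-lub (∪-monoʳ-⊆ A (x∈p⇒⁅x⁆⊆p pivot∈S)) (q⊆p∪q A S ∘ p∩q⊆p S (below pivot))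

      drop-pivot : ((A ∪ ⁅ pivot ⁆) ∪ (S ∩ below pivot)) - pivot ⊆ A ∪ (S ∩ below pivot)
      drop-pivot x∈ with x∈p∪q⁻ _ _ (p─q⊆p _ _ x∈)
      ... | inj₂ x∈S′ = q⊆p∪q A _ x∈S′
      ... | inj₁ x∈A′ with x∈p∪q⁻ A ⁅ pivot ⁆ x∈A′
      ...   | inj₁ x∈A      = p⊆p∪q _ x∈A
      ...   | inj₂ x∈pivot  = ⊥-elim (x∈p-y⇒x≢y x∈ (x∈⁅y⁆⇒x≡y pivot x∈pivot))

      critical′ : ∀ {i} → i ∈ A ∪ ⁅ pivot ⁆ → f (((A ∪ ⁅ pivot ⁆) ∪ (S ∩ below pivot)) - i) ≡ false
      critical′ {i} i∈ with x∈p∪q⁻ A ⁅ pivot ⁆ i∈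
      ... | inj₁ i∈A     = false-⊇ (p⊆q⇒p-x⊆q-x shrinks) (critical i∈A)
      ... | inj₂ i∈pivot rewrite x∈⁅y⁆⇒x≡y pivot i∈pivot = false-⊇ drop-pivot rejects

  record Outcome (F : ℕ) (A S : Subset n) : Set where
    field
      output  : Subset n
      queries : ℕ
      runs    : run f (certLoop F A S) ≡ (just output , queries)
      cost    : queries + ∣ A ∣ * (3 + ⌈log₂ n ⌉) ≤ ∣ output ∣ * (3 + ⌈log₂ n ⌉) + 1
      minterm : Minterm f output

  -- At most n − |A| further rounds grow A, and each binary search gets one unit of fuel less than
  -- its round and needs n.
  certLoop-outcome : ∀ F A S → suc (n + n) ≤ F + ∣ A ∣ → Invariant A S → Outcome F A S
  certLoop-outcome zero    A S fuel _   = ⊥-elim (ℕ.<-irrefl refl (ℕ.≤-trans (s≤s (ℕ.m≤m+n n n)) (ℕ.≤-trans fuel (∣p∣≤n A))))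
  certLoop-outcome (suc k) A S fuel inv = continue (f A) refl
    where
    open Invariant inv

    continue : ∀ b → f A ≡ b → Outcome (suc k) A S
    continue true fA = record
      { output = A ; queries = 1 ; runs = run-certLoop-accept f fA
      ; cost = ℕ.≤-reflexive (ℕ.+-comm 1 _)
      ; minterm = fA , λ i∈A → false-⊇ (p⊆q⇒p-x⊆q-x (p⊆p∪q S)) (critical i∈A) }
    continue false fA = record
      { output = output ; queries = 3 + (R.queries + queries)
      ; runs = run-certLoop-continue f fA accepts R.runs runs
      ; cost = round-cost R.cost A<A′ cost ; minterm = minterm }
      where
      n≤k : n ≤ k
      n≤k = ℕ.+-cancelʳ-≤ n n k (ℕ.≤-trans (ℕ.≤-pred fuel) (ℕ.+-monoʳ-≤ k (∣p∣≤n A)))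
      r : SearchResult k A S
      r = search-finds n≤k fA accepts
      module R = SearchResult r
      A<A′ : ∣ A ∣ < ∣ A ∪ ⁅ R.pivot ⁆ ∣
      A<A′ = x∉p⇒∣p∣<∣p∪⁅x⁆∣ (pivot∉A inv r)
      fuel′ : suc (n + n) ≤ k + ∣ A ∪ ⁅ R.pivot ⁆ ∣
      fuel′ = ℕ.≤-trans fuel (ℕ.≤-trans (ℕ.≤-reflexive (sym (ℕ.+-suc k ∣ A ∣))) (ℕ.+-monoʳ-≤ k A<A′))
      open Outcome (certLoop-outcome k (A ∪ ⁅ R.pivot ⁆) (S ∩ below R.pivot) fuel′ (invariant-step inv r))

lemma3p4 : ∃[ c ] (∀ (n : ℕ) (f : BoolFun n) → Monotone f →
               ∀ (x⋆ : Subset n) → f x⋆ ≡ true →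
               ∀ (k : ℕ) → IsCertComplexity f k →
               ∃[ fuel ] ∃[ A ] ∃[ q ]
                 (run f (CERT fuel x⋆) ≡ (just A , q) × q ≤ c * k * ⌈log₂ n ⌉ + c))
lemma3p4 = 4 , certBound
  where
  certBound : ∀ n (f : BoolFun n) → Monotone f → ∀ x⋆ → f x⋆ ≡ true → ∀ k → IsCertComplexity f k →
              ∃[ fuel ] ∃[ A ] ∃[ q ] (run f (CERT fuel x⋆) ≡ (just A , q) × q ≤ 4 * k * ⌈log₂ n ⌉ + 4)
  certBound n f mono x⋆ fx⋆ k (C≤k , _) =
    suc (n + n) , output , queries , runs ,
    query-bound (C≤k output ∣ output ∣ (minterm⇒IsCertComplexityAt mono minterm)) (∣p∣≤n output)
                (ℕ.≤-trans (ℕ.m≤m+n queries _) cost)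
    where
    open CertLoop f mono
    initial : Invariant ⊥ x⋆
    initial = record { accepts = subst (λ X → f X ≡ true) (sym (∪-identityˡ x⋆)) fx⋆
                     ; critical = λ i∈⊥ → ⊥-elim (∉⊥ i∈⊥) }
    open Outcome (certLoop-outcome (suc (n + n)) ⊥ x⋆ (ℕ.m≤m+n _ _) initial)
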